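{- Let $\sigma$ and $\pi$ be permutations. If $\sigma \preceq \pi$, then $\mathrm{sh}(\sigma) \sqsubseteq \mathrm{sh}(\pi)$.
   Context: A partition $\lambda=(\lambda_1,\ldots,\lambda_k)$ is a weakly decreasing sequence of positive integers; $|\lambda|=\sum_i\lambda_i$, and $\lambda$ is regarded as extended by trailing zeros when convenient. The conjugate partition $\lambda^*$ is given by $\lambda^*_i = |\{j : \lambda_j \ge i\}|$. For partitions $\lambda,\mu$, $\mu$ dominates $\lambda$, written $\lambda \trianglelefteq \mu$, if $\sum_{i=1}^k \lambda_i \le \sum_{i=1}^k \mu_i$ for all $k\ge 1$. $\mu$ doubly dominates $\lambda$, written $\lambda \sqsubseteq \mu$, if both $\lambda \trianglelefteq \mu$ and $\lambda^* \trianglelefteq \mu^*$. For a permutation $\pi$, $\mathrm{sh}(\pi)$ is the common shape of the two Young tableaux associated to $\pi$ by the Robinson–Schensted–Knuth correspondence. For permutations $\sigma$ (of length $k$) and $\pi$ (of length $n$), $\sigma \preceq \pi$ ($\sigma$ is involved in $\pi$) means some length-$k$ subsequence of the sequence of values of $\pi$ has its terms in the same relative order as the values of $\sigma$. -}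

module Defs where

open import Data.Nat using (ℕ; zero; suc; _≤_; _<_; _<?_; _≤?_; _⊔_)
open import Data.List using (List; []; _∷_; length; lookup; map; filter; take; foldl; foldr; upTo; applyUpTo)
open import Data.Nat.ListAction using (sum)
open import Data.List.Relation.Binary.Permutation.Propositional using (_↭_)
open import Data.List.Relation.Binary.Sublist.Propositional using (_⊆_)
open import Data.Fin using (Fin; cast)
open import Data.Maybe using (Maybe; just; nothing)
open import Data.Product using (Σ; ∃; ∃-syntax; _×_; _,_)
open import Relation.Nullary using (yes; no)
open import Relation.Binary.PropositionalEquality using (_≡_)
open import Function.Bundles using (_⇔_)

-- A permutation of length n is a list of the values 0,…,n-1, each once
-- (written in one-line notation π(1) π(2) … π(n)).
IsPerm : List ℕ → Set
IsPerm π = π ↭ upTo (length π)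

SameOrder : List ℕ → List ℕ → Set
SameOrder xs ys =
  Σ (length xs ≡ length ys) λ eq →
    ∀ (i j : Fin (length xs)) →
      (lookup xs i < lookup xs j) ⇔ (lookup ys (cast eq i) < lookup ys (cast eq j))

_⪯_ : List ℕ → List ℕ → Set
σ ⪯ π = ∃[ τ ] (τ ⊆ π × SameOrder σ τ)

Tableau : Set
Tableau = List (List ℕ)

insertRow : ℕ → List ℕ → List ℕ × Maybe ℕ
insertRow x [] = (x ∷ [] , nothing)
insertRow x (y ∷ ys) with x <? y
... | yes _ = (x ∷ ys , just y)
... | no _ with insertRow x ys
...   | (r , b) = (y ∷ r , b)

-- Row-insert x into a tableau (rows listed from top to bottom).
insertTab : ℕ → Tableau → Tableau
insertTab x [] = (x ∷ []) ∷ []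
insertTab x (r ∷ rs) with insertRow x r
... | (r' , nothing) = r' ∷ rs
... | (r' , just y)  = r' ∷ insertTab y rs

Ptab : List ℕ → Tableau
Ptab π = foldl (λ T x → insertTab x T) [] π

-- RSK shape (row lengths of P(π), which equal those of Q(π)).
sh : List ℕ → List ℕ
sh π = map length (Ptab π)

maxList : List ℕ → ℕ
maxList = foldr _⊔_ 0

conj : List ℕ → List ℕ
conj l = applyUpTo (λ i → length (filter (λ x → suc i ≤? x) l)) (maxList l)

-- λ ⊴ μ : all partial sums of λ are ≤ those of μ (trailing zeros implicit).
_⊴_ : List ℕ → List ℕ → Set
l ⊴ m = ∀ (k : ℕ) → sum (take k l) ≤ sum (take k m)

_⊑_ : List ℕ → List ℕ → Set
l ⊑ m = (l ⊴ m) × (conj l ⊴ conj m)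

-- For a word w let gₖ(w) be the largest length of a subsequence of w containing no strictly
-- decreasing subsequence of length k + 1, and gₖ*(w) the same with weakly increasing ones.
-- By Greene's theorem gₖ(w) and gₖ*(w) are the sums of the first k rows and of the first k
-- columns of sh(w). Both are monotone under involvement, since an occurrence of σ in π carries
-- subsequences of σ to subsequences of π with the same chains. To compute them, note that w is
-- Knuth equivalent to the reading word of its insertion tableau, that an elementary Knuth move
-- does not change gₖ or gₖ* (a chain broken by the move can be repaired through its third
-- letter), and that on the reading word of a tableau the first k rows (for gₖ*: the first k
-- columns) are admissible, while an admissible subsequence meets each column (for gₖ*: each
-- row) in at most k entries.
module Submission where

open import Defs
open import Level using (0ℓ)
open import Data.Nat using (ℕ; zero; suc; _+_; _≤_; _<_; _>_; _<ᵇ_; _≤?_; _<?_; z≤n; s≤s; _⊓_; pred)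
open import Data.Nat.Properties
open import Data.List using (List; []; _∷_; _++_; [_]; length; map; filter; take; foldl; applyUpTo; lookup)
open import Data.List.Properties using (++-assoc; length-++; ++-identityʳ; length-take; length-map; take-map)
open import Data.Nat.ListAction using (sum)
open import Data.List.Relation.Binary.Sublist.Propositional using (_⊆_; []; _∷_; _∷ʳ_; ⊆-refl; ⊆-trans)
open import Data.List.Relation.Binary.Sublist.Propositional.Properties
  using ([]⊆-universal; ++⁺; ++⁺ˡ; ++⁺ʳ; ∷ˡ⁻; length-mono-≤; take-⊆; All-resp-⊆)
open import Data.List.Relation.Unary.All as All using (All; []; _∷_)
import Data.List.Relation.Unary.All.Properties as All
open import Data.List.Relation.Binary.Pointwise using (Pointwise; []; _∷_)
import Data.List.Relation.Binary.Pointwise.Properties as Pointwise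
open import Data.List.Relation.Binary.Prefix.Heterogeneous using (Prefix; []; _∷_; _++ᵖ_)
import Data.List.Relation.Binary.Prefix.Heterogeneous.Properties as Prefix
open import Data.List.Relation.Unary.AllPairs using (AllPairs; []; _∷_)
import Data.List.Relation.Unary.AllPairs.Properties as AllPairs
open import Data.Product as Product using (∃; ∃₂; _×_; _,_; proj₁; proj₂)
open import Data.Sum using (_⊎_; inj₁; inj₂)
open import Data.Empty using (⊥-elim)
open import Data.Unit using (⊤; tt)
open import Data.Bool using (true; false)
open import Data.Maybe using (Maybe; just; nothing)
open import Relation.Binary using (Rel; Decidable; Transitive)
open import Relation.Nullary using (¬_; Dec; yes; no)
open import Relation.Nullary.Decidable using (_×-dec_)
open import Relation.Binary.PropositionalEquality
  using (_≡_; refl; sym; trans; cong; cong₂; subst; subst₂; module ≡-Reasoning)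
open import Function.Bundles using (_⇔_; Equivalence)
open import Function.Properties.Equivalence using () renaming (sym to ⇔-sym)
import Data.Fin as Fin

⊆-++⁻ : ∀ {X : Set} (A : List X) {B C : List X} → C ⊆ A ++ B →
        ∃₂ λ C₁ C₂ → C ≡ C₁ ++ C₂ × C₁ ⊆ A × C₂ ⊆ B
⊆-++⁻ []      p         = [] , _ , refl , [] , p
⊆-++⁻ (a ∷ A) (.a ∷ʳ p) with ⊆-++⁻ A p
... | C₁ , C₂ , refl , p₁ , p₂ = C₁ , C₂ , refl , a ∷ʳ p₁ , p₂
⊆-++⁻ (a ∷ A) (refl ∷ p) with ⊆-++⁻ A p
... | C₁ , C₂ , refl , p₁ , p₂ = a ∷ C₁ , C₂ , refl , refl ∷ p₁ , p₂

⊆-++-∷ʳ⁻ : ∀ {X : Set} (A : List X) y {C : List X} → C ⊆ A ++ [ y ] →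
           C ⊆ A ⊎ ∃ λ C₁ → C₁ ⊆ A × C ≡ C₁ ++ [ y ]
⊆-++-∷ʳ⁻ A y p with ⊆-++⁻ A p
... | C₁ , [] , refl , p₁ , _ = inj₁ (subst (_⊆ A) (sym (++-identityʳ C₁)) p₁)
... | C₁ , .y ∷ [] , refl , p₁ , (refl ∷ []) = inj₂ (C₁ , p₁ , refl)

⊆-swap⁻ : ∀ {X : Set} (A : List X) a b {B C : List X} → C ⊆ A ++ b ∷ a ∷ B →
          C ⊆ A ++ a ∷ b ∷ B ⊎ ∃₂ λ CA CB → CA ⊆ A × CB ⊆ B × C ≡ CA ++ b ∷ a ∷ CB
⊆-swap⁻ A a b p with ⊆-++⁻ A p
... | C₁ , _ , refl , p₁ , (.b ∷ʳ (.a ∷ʳ q)) = inj₁ (++⁺ p₁ (a ∷ʳ (b ∷ʳ q)))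
... | C₁ , _ , refl , p₁ , (.b ∷ʳ (refl ∷ q)) = inj₁ (++⁺ p₁ (refl ∷ (b ∷ʳ q)))
... | C₁ , _ , refl , p₁ , (refl ∷ (.a ∷ʳ q)) = inj₁ (++⁺ p₁ (a ∷ʳ (refl ∷ q)))
... | C₁ , _ , refl , p₁ , (refl ∷ (refl ∷ q)) = inj₂ (C₁ , _ , p₁ , q , refl)

length-++-∷∷ : ∀ {X : Set} (A : List X) u v u′ v′ (B : List X) →
               length (A ++ u ∷ v ∷ B) ≡ length (A ++ u′ ∷ v′ ∷ B)
length-++-∷∷ []      u v u′ v′ B = refl
length-++-∷∷ (x ∷ A) u v u′ v′ B = cong suc (length-++-∷∷ A u v u′ v′ B)

module _ {X : Set} {R : Rel X 0ℓ} where

  AllPairs-resp-⊆ : ∀ {xs ys} → xs ⊆ ys → AllPairs R ys → AllPairs R xs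
  AllPairs-resp-⊆ []         rs        = rs
  AllPairs-resp-⊆ (y ∷ʳ p)   (_ ∷ rs)  = AllPairs-resp-⊆ p rs
  AllPairs-resp-⊆ (refl ∷ p) (r ∷ rs)  = All-resp-⊆ p r ∷ AllPairs-resp-⊆ p rs

  AllPairs-++⁻ : ∀ xs {ys} → AllPairs R (xs ++ ys) →
                 AllPairs R xs × AllPairs R ys × All (λ x → All (R x) ys) xs
  AllPairs-++⁻ []       rs       = [] , rs , []
  AllPairs-++⁻ (x ∷ xs) (r ∷ rs) with AllPairs-++⁻ xs rs
  ... | rxs , rys , cross = All.++⁻ˡ xs r ∷ rxs , rys , All.++⁻ʳ xs r ∷ cross

  AllPairs-++-∷⁻ : ∀ xs {u ys} → AllPairs R (xs ++ u ∷ ys) →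
                   AllPairs R xs × All (λ x → R x u) xs × AllPairs R (u ∷ ys)
  AllPairs-++-∷⁻ xs rs with AllPairs-++⁻ xs rs
  ... | rxs , rys , cross = rxs , All.map (λ { (r ∷ _) → r }) cross , rys

  AllPairs-++-∷⁺ : Transitive R → ∀ {xs u ys} → AllPairs R xs → All (λ x → R x u) xs →
                   AllPairs R (u ∷ ys) → AllPairs R (xs ++ u ∷ ys)
  AllPairs-++-∷⁺ R-trans rxs xu (uys ∷ rys) =
    AllPairs.++⁺ rxs (uys ∷ rys) (All.map (λ r → r ∷ All.map (R-trans r) uys) xu)

infix 4 _∼_

data _∼_ : List ℕ → List ℕ → Set where
  ∼-refl  : ∀ {u} → u ∼ u
  ∼-sym   : ∀ {u v} → u ∼ v → v ∼ u
  ∼-trans : ∀ {u v w} → u ∼ v → v ∼ w → u ∼ w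
  yxz∼yzx : ∀ p s {x y z} → x < y → y ≤ z → p ++ y ∷ x ∷ z ∷ s ∼ p ++ y ∷ z ∷ x ∷ s
  xzy∼zxy : ∀ p s {x y z} → x ≤ y → y < z → p ++ x ∷ z ∷ y ∷ s ∼ p ++ z ∷ x ∷ y ∷ s

∼-reflexive : ∀ {u v} → u ≡ v → u ∼ v
∼-reflexive refl = ∼-refl

∼-++ˡ : ∀ q {u v} → u ∼ v → q ++ u ∼ q ++ v
∼-++ˡ q ∼-refl          = ∼-refl
∼-++ˡ q (∼-sym e)       = ∼-sym (∼-++ˡ q e)
∼-++ˡ q (∼-trans e f)   = ∼-trans (∼-++ˡ q e) (∼-++ˡ q f)
∼-++ˡ q (yxz∼yzx p s x<y y≤z) =
  subst₂ _∼_ (++-assoc q p _) (++-assoc q p _) (yxz∼yzx (q ++ p) s x<y y≤z)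
∼-++ˡ q (xzy∼zxy p s x≤y y<z) =
  subst₂ _∼_ (++-assoc q p _) (++-assoc q p _) (xzy∼zxy (q ++ p) s x≤y y<z)

∼-++ʳ : ∀ q {u v} → u ∼ v → u ++ q ∼ v ++ q
∼-++ʳ q ∼-refl        = ∼-refl
∼-++ʳ q (∼-sym e)     = ∼-sym (∼-++ʳ q e)
∼-++ʳ q (∼-trans e f) = ∼-trans (∼-++ʳ q e) (∼-++ʳ q f)
∼-++ʳ q (yxz∼yzx p s x<y y≤z) =
  subst₂ _∼_ (sym (++-assoc p _ q)) (sym (++-assoc p _ q)) (yxz∼yzx p (s ++ q) x<y y≤z)
∼-++ʳ q (xzy∼zxy p s x≤y y<z) =
  subst₂ _∼_ (sym (++-assoc p _ q)) (sym (++-assoc p _ q)) (xzy∼zxy p (s ++ q) x≤y y<z)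

-- Row insertion is a sequence of Knuth moves

NonDecreasing : List ℕ → Set
NonDecreasing = AllPairs _≤_

reading : Tableau → List ℕ
reading []       = []
reading (r ∷ rs) = reading rs ++ r

∷-++-∷ʳ∼ : ∀ a v x → x < a → NonDecreasing (a ∷ v) → a ∷ v ++ [ x ] ∼ a ∷ x ∷ v
∷-++-∷ʳ∼ a []      x x<a _                  = ∼-refl
∷-++-∷ʳ∼ a (b ∷ v) x x<a ((a≤b ∷ _) ∷ b∷v↑) =
  ∼-trans (∼-++ˡ [ a ] (∷-++-∷ʳ∼ b v x (<-≤-trans x<a a≤b) b∷v↑)) (∼-sym (yxz∼yzx [] v x<a a≤b))

record Bump (x : ℕ) (r r′ : List ℕ) (c : ℕ) : Set where
  field
    knuth      : r ++ [ x ] ∼ c ∷ r′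
    x<c        : x < c
    head≤x     : ∃₂ λ h r″ → r′ ≡ h ∷ r″ × h ≤ x
    keepsLower : ∀ m → m ≤ x → All (m ≤_) r → All (m ≤_) r′
    sorted     : NonDecreasing r′
    lowers     : Pointwise _≤_ r′ r

InsertRowSpec : ℕ → List ℕ → List ℕ × Maybe ℕ → Set
InsertRowSpec x r (r′ , nothing) = r′ ≡ r ++ [ x ] × All (_≤ x) r
InsertRowSpec x r (r′ , just c)  = Bump x r r′ c

insertRow-spec : ∀ x r → NonDecreasing r → InsertRowSpec x r (insertRow x r)
insertRow-spec x []       _          = refl , []
insertRow-spec x (y ∷ ys) (y≤ys ∷ ys↑) with x <? y
... | yes x<y = record
  { knuth      = ∷-++-∷ʳ∼ y ys x x<y (y≤ys ∷ ys↑)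
  ; x<c        = x<y
  ; head≤x     = x , ys , refl , ≤-refl
  ; keepsLower = λ { m m≤x (_ ∷ m≤ys) → m≤x ∷ m≤ys }
  ; sorted     = All.map (≤-trans (<⇒≤ x<y)) y≤ys ∷ ys↑
  ; lowers     = <⇒≤ x<y ∷ Pointwise.refl ≤-refl
  }
... | no x≮y with insertRow x ys | insertRow-spec x ys ys↑
...   | r , nothing | refl , ys≤x = refl , ≮⇒≥ x≮y ∷ ys≤x
...   | r , just c  | bump = record
  { knuth      = ∼-trans (∼-++ˡ [ y ] knuth) (y∷c∼c∷y head≤x)
  ; x<c        = x<c
  ; head≤x     = y , r , refl , ≮⇒≥ x≮y
  ; keepsLower = λ { m m≤x (m≤y ∷ m≤ys) → m≤y ∷ keepsLower m m≤x m≤ys }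
  ; sorted     = keepsLower y (≮⇒≥ x≮y) y≤ys ∷ sorted
  ; lowers     = ≤-refl ∷ lowers
  }
  where
  open Bump bump
  y∷c∼c∷y : (∃₂ λ h r″ → r ≡ h ∷ r″ × h ≤ x) → y ∷ c ∷ r ∼ c ∷ y ∷ r
  y∷c∼c∷y (h , r″ , refl , h≤x) with keepsLower y (≮⇒≥ x≮y) y≤ys
  ... | y≤h ∷ _ = xzy∼zxy [] r″ y≤h (≤-<-trans h≤x x<c)

insertTab-∼ : ∀ x T → All NonDecreasing T →
              reading T ++ [ x ] ∼ reading (insertTab x T) × All NonDecreasing (insertTab x T)
insertTab-∼ x []       []          = ∼-refl , ([] ∷ []) ∷ []
insertTab-∼ x (r ∷ rs) (r↑ ∷ rs↑) with insertRow x r | insertRow-spec x r r↑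
... | r′ , nothing | refl , r≤x =
  ∼-reflexive (++-assoc (reading rs) r _) ,
  AllPairs.++⁺ r↑ ([] ∷ []) (All.map (_∷ []) r≤x) ∷ rs↑
... | r′ , just c  | bump with insertTab-∼ c rs rs↑
...   | rs∼ , rs′↑ = ∼-trans (∼-reflexive (++-assoc (reading rs) r _))
                       (∼-trans (∼-++ˡ (reading rs) (Bump.knuth bump))
                       (∼-trans (∼-reflexive (sym (++-assoc (reading rs) [ c ] r′)))
                                (∼-++ʳ r′ rs∼))) ,
                     Bump.sorted bump ∷ rs′↑

insertAll : List ℕ → Tableau → Tableau
insertAll w T = foldl (λ T x → insertTab x T) T w

insertAll-∼ : ∀ w T → All NonDecreasing T →
              reading T ++ w ∼ reading (insertAll w T) × All NonDecreasing (insertAll w T)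
insertAll-∼ []      T T↑ = ∼-reflexive (++-identityʳ (reading T)) , T↑
insertAll-∼ (x ∷ w) T T↑ with insertTab-∼ x T T↑
... | ins∼ , T′↑ with insertAll-∼ w (insertTab x T) T′↑
...   | rest∼ , T″↑ =
  ∼-trans (∼-reflexive (sym (++-assoc (reading T) [ x ] w))) (∼-trans (∼-++ʳ w ins∼) rest∼) , T″↑

Ptab-∼ : ∀ w → w ∼ reading (Ptab w)
Ptab-∼ w = proj₁ (insertAll-∼ w [] [])

Ptab-rows : ∀ w → All NonDecreasing (Ptab w)
Ptab-rows w = proj₂ (insertAll-∼ w [] [])

-- Row insertion keeps columns strictly increasing

-- r₂ may sit directly below r: it is no longer, and entrywise strictly larger.
_above_ : List ℕ → List ℕ → Set
r above r₂ = Prefix _>_ r₂ r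

headRow : Tableau → List ℕ
headRow []      = []
headRow (r ∷ _) = r

data ColumnStrict : Tableau → Set where
  []  : ColumnStrict []
  _∷_ : ∀ {r T} → r above headRow T → ColumnStrict T → ColumnStrict (r ∷ T)

above-resp-≤ : ∀ {r r′ r₂} → Pointwise _≤_ r′ r → r above r₂ → r′ above r₂
above-resp-≤ _             []         = []
above-resp-≤ (a′≤a ∷ r′≤r) (a<b ∷ ab) = ≤-<-trans a′≤a a<b ∷ above-resp-≤ r′≤r ab

WhenBumped : (List ℕ → ℕ → Set) → List ℕ × Maybe ℕ → Set
WhenBumped P (r′ , nothing) = ⊤
WhenBumped P (r′ , just c)  = P r′ c

-- The entry bumped out of a row lands weakly left of the position it left.
insertRow-above : ∀ x r r₂ → NonDecreasing r → r above r₂ →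
                  WhenBumped (λ r′ c → r′ above proj₁ (insertRow c r₂)) (insertRow x r)
insertRow-above x []      r₂ _ _ = tt
insertRow-above x (a ∷ s) r₂ (_ ∷ s↑) ab with x <? a
insertRow-above x (a ∷ s) []       _ _          | yes x<a = x<a ∷ []
insertRow-above x (a ∷ s) (b ∷ s₂) _ (a<b ∷ ab) | yes x<a with a <? b
... | yes _  = x<a ∷ ab
... | no a≮b = ⊥-elim (a≮b a<b)
insertRow-above x (a ∷ s) []       (_ ∷ s↑) _ | no x≮a with insertRow x s | insertRow-spec x s s↑
... | s′ , nothing | _    = tt
... | s′ , just c  | bump = ≤-<-trans (≮⇒≥ x≮a) (Bump.x<c bump) ∷ []
insertRow-above x (a ∷ s) (b ∷ s₂) (_ ∷ s↑) (a<b ∷ ab) | no x≮a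
  with insertRow x s | insertRow-spec x s s↑ | insertRow-above x s s₂ s↑ ab
... | s′ , nothing | _    | _  = tt
... | s′ , just c  | bump | ih with c <? b
...   | yes _ = ≤-<-trans (≮⇒≥ x≮a) (Bump.x<c bump) ∷ above-resp-≤ (Bump.lowers bump) ab
...   | no _  = a<b ∷ ih

headRow-insertTab : ∀ c T → headRow (insertTab c T) ≡ proj₁ (insertRow c (headRow T))
headRow-insertTab c []      = refl
headRow-insertTab c (r ∷ T) with insertRow c r
... | r′ , nothing = refl
... | r′ , just d  = refl

insertTab-columnStrict : ∀ x T → All NonDecreasing T → ColumnStrict T → ColumnStrict (insertTab x T)
insertTab-columnStrict x []       []          []          = [] ∷ []
insertTab-columnStrict x (r ∷ rs) (r↑ ∷ rs↑) (ab ∷ rs↓)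
  with insertRow x r | insertRow-spec x r r↑ | insertRow-above x r (headRow rs) r↑ ab
... | r′ , nothing | refl , _ | _   = (ab ++ᵖ [ x ]) ∷ rs↓
... | r′ , just c  | _        | ab′ =
  subst (r′ above_) (sym (headRow-insertTab c rs)) ab′ ∷ insertTab-columnStrict c rs rs↑ rs↓

insertAll-columnStrict : ∀ w T → All NonDecreasing T → ColumnStrict T → ColumnStrict (insertAll w T)
insertAll-columnStrict []      T T↑ T↓ = T↓
insertAll-columnStrict (x ∷ w) T T↑ T↓ =
  insertAll-columnStrict w (insertTab x T) (proj₂ (insertTab-∼ x T T↑)) (insertTab-columnStrict x T T↑ T↓)

Ptab-columns : ∀ w → ColumnStrict (Ptab w)
Ptab-columns w = insertAll-columnStrict w [] [] []

SameCmp : ℕ → ℕ → ℕ → ℕ → Set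
SameCmp x y x′ y′ = (x < x′ ⇔ y < y′) × (x′ < x ⇔ y′ < y)

data OrderIso : List ℕ → List ℕ → Set where
  []  : OrderIso [] []
  _∷_ : ∀ {x y xs ys} → Pointwise (SameCmp x y) xs ys → OrderIso xs ys → OrderIso (x ∷ xs) (y ∷ ys)

SameOrder⇒OrderIso : ∀ xs ys → SameOrder xs ys → OrderIso xs ys
SameOrder⇒OrderIso []       []       _       = []
SameOrder⇒OrderIso (x ∷ xs) (y ∷ ys) (eq , f) =
  heads xs ys (cong pred eq) (λ j → f Fin.zero (Fin.suc j) , f (Fin.suc j) Fin.zero) ∷
  SameOrder⇒OrderIso xs ys (cong pred eq , λ i j → f (Fin.suc i) (Fin.suc j))
  where
  heads : ∀ xs ys (e : length xs ≡ length ys) →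
          (∀ j → SameCmp x y (lookup xs j) (lookup ys (Fin.cast e j))) → Pointwise (SameCmp x y) xs ys
  heads []        []        e h = []
  heads (x′ ∷ xs) (y′ ∷ ys) e h = h Fin.zero ∷ heads xs ys (cong pred e) (λ j → h (Fin.suc j))

OrderIso-sym : ∀ {xs ys} → OrderIso xs ys → OrderIso ys xs
OrderIso-sym []        = []
OrderIso-sym (w ∷ iso) = Pointwise.symmetric (Product.map ⇔-sym ⇔-sym) w ∷ OrderIso-sym iso

OrderIso-length : ∀ {xs ys} → OrderIso xs ys → length xs ≡ length ys
OrderIso-length []        = refl
OrderIso-length (_ ∷ iso) = cong suc (OrderIso-length iso)

select : ∀ {S xs : List ℕ} → S ⊆ xs → List ℕ → List ℕ
select []       _        = []
select (_ ∷ʳ p) []       = []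
select (_ ∷ʳ p) (y ∷ ys) = select p ys
select (_ ∷ p)  []       = []
select (_ ∷ p)  (y ∷ ys) = y ∷ select p ys

select-⊆ : ∀ {S xs ys} → OrderIso xs ys → (p : S ⊆ xs) → select p ys ⊆ ys
select-⊆ []                        []         = []
select-⊆ (_∷_ {y = y} _ iso) (_ ∷ʳ p)   = y ∷ʳ select-⊆ iso p
select-⊆ (_ ∷ iso)           (refl ∷ p) = refl ∷ select-⊆ iso p

Pointwise-select : ∀ {Q : ℕ → ℕ → Set} {S xs ys} → Pointwise Q xs ys → (p : S ⊆ xs) →
                   Pointwise Q S (select p ys)
Pointwise-select []      []         = []
Pointwise-select (_ ∷ w) (_ ∷ʳ p)   = Pointwise-select w p
Pointwise-select (q ∷ w) (refl ∷ p) = q ∷ Pointwise-select w p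

OrderIso-select : ∀ {S xs ys} → OrderIso xs ys → (p : S ⊆ xs) → OrderIso S (select p ys)
OrderIso-select []        []         = []
OrderIso-select (_ ∷ iso) (_ ∷ʳ p)   = OrderIso-select iso p
OrderIso-select (w ∷ iso) (refl ∷ p) = Pointwise-select w p ∷ OrderIso-select iso p

-- Greene's invariants: long subsequences without long chains

module Greene (R : Rel ℕ 0ℓ) where

  Chains≤ : ℕ → List ℕ → Set
  Chains≤ k S = ∀ {C} → C ⊆ S → AllPairs R C → length C ≤ k

  Chains≤-resp-⊆ : ∀ {k S S′} → S ⊆ S′ → Chains≤ k S′ → Chains≤ k S
  Chains≤-resp-⊆ S⊆S′ bounded p = bounded (⊆-trans p S⊆S′)

  infix 4 _≼_

  _≼_ : List ℕ → List ℕ → Set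
  u ≼ v = ∀ k {S} → S ⊆ u → Chains≤ k S → ∃ λ S′ → S′ ⊆ v × Chains≤ k S′ × length S′ ≡ length S

  ≼-refl : ∀ {u} → u ≼ u
  ≼-refl k {S} p bounded = S , p , bounded , refl

  ≼-trans : ∀ {u v w} → u ≼ v → v ≼ w → u ≼ w
  ≼-trans u≼v v≼w k p bounded with u≼v k p bounded
  ... | S₁ , p₁ , bounded₁ , eq₁ with v≼w k p₁ bounded₁
  ...   | S₂ , p₂ , bounded₂ , eq₂ = S₂ , p₂ , bounded₂ , trans eq₂ eq₁

  ⊆⇒≼ : ∀ {u v} → u ⊆ v → u ≼ v
  ⊆⇒≼ u⊆v k {S} p bounded = S , ⊆-trans p u⊆v , bounded , refl

  ≼⇒≤ : ∀ {u v} → u ≼ v → ∀ k {n m} →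
        (∃ λ S → S ⊆ u × Chains≤ k S × length S ≡ n) →
        (∀ {S} → S ⊆ v → Chains≤ k S → length S ≤ m) → n ≤ m
  ≼⇒≤ u≼v k (S , p , bounded , refl) bound with u≼v k p bounded
  ... | S′ , p′ , bounded′ , eq = subst (_≤ _) eq (bound p′ bounded′)

  module _ (R? : Decidable R) where

    chain? : (P : ℕ → Set) → (∀ a → Dec (P a)) → ∀ m S →
             (∃ λ C → C ⊆ S × All P C × AllPairs R C × length C ≡ m) ⊎
             (∀ {C} → C ⊆ S → All P C → AllPairs R C → length C < m)
    chain? P P? zero    S       = inj₁ ([] , []⊆-universal S , [] , [] , refl)
    chain? P P? (suc m) []      = inj₂ λ { [] _ _ → s≤s z≤n }
    chain? P P? (suc m) (a ∷ S) with chain? P P? (suc m) S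
    ... | inj₁ (C , p , q , r , e) = inj₁ (C , a ∷ʳ p , q , r , e)
    ... | inj₂ short with P? a
    ...   | no ¬pa = inj₂ λ { (_ ∷ʳ p) q r → short p q r ; (refl ∷ p) (pa ∷ q) r → ⊥-elim (¬pa pa) }
    ...   | yes pa with chain? (λ b → P b × R a b) (λ b → P? b ×-dec R? a b) m S
    ...     | inj₁ (C , p , q , r , e) =
              inj₁ (a ∷ C , refl ∷ p , pa ∷ All.map proj₁ q , All.map proj₂ q ∷ r , cong suc e)
    ...     | inj₂ short′ = inj₂ λ { (_ ∷ʳ p) q r → short p q r
                                   ; (refl ∷ p) (_ ∷ q) (r₀ ∷ r) → s≤s (short′ p (All.zip (q , r₀)) r) }

    chains≤? : ∀ k S → Chains≤ k S ⊎ ∃ λ C → C ⊆ S × AllPairs R C × length C ≡ suc k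
    chains≤? k S with chain? (λ _ → ⊤) (λ _ → yes tt) (suc k) S
    ... | inj₁ (C , p , _ , r , e) = inj₂ (C , p , r , e)
    ... | inj₂ short               = inj₁ λ p r → ≤-pred (short p (All.universal (λ _ → tt) _) r)

  SwapChainsLift : List ℕ → ℕ → ℕ → List ℕ → Set
  SwapChainsLift A a b B = ∀ {CA CB} → CA ⊆ A → CB ⊆ B → AllPairs R (CA ++ b ∷ a ∷ CB) →
    ∃ λ D → D ⊆ A ++ a ∷ b ∷ B × AllPairs R D × length (CA ++ b ∷ a ∷ CB) ≤ length D

  Chains≤-swap : ∀ {k} A a b B → SwapChainsLift A a b B →
                 Chains≤ k (A ++ a ∷ b ∷ B) → Chains≤ k (A ++ b ∷ a ∷ B)
  Chains≤-swap A a b B lift bounded p r with ⊆-swap⁻ A a b p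
  ... | inj₁ q = bounded q r
  ... | inj₂ (CA , CB , pa , pb , refl) with lift pa pb r
  ...   | D , pd , rd , le = ≤-trans le (bounded pd rd)

  unrelated-swapChainsLift : ∀ A a b B → ¬ R b a → SwapChainsLift A a b B
  unrelated-swapChainsLift A a b B ¬bRa {CA} _ _ r with AllPairs-++-∷⁻ CA r
  ... | _ , _ , (bRa ∷ _) ∷ _ = ⊥-elim (¬bRa bRa)

  SwapChainsMerge : List ℕ → ℕ → ℕ → List ℕ → List ℕ → Set
  SwapChainsMerge A a b B M = ∀ {CA CB CA′ m CB′} → CA ⊆ A → CB ⊆ B → CA′ ⊆ A → m ⊆ M → CB′ ⊆ B →
    AllPairs R (CA ++ b ∷ a ∷ CB) → AllPairs R (CA′ ++ m ++ CB′) →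
    ∃ λ D → D ⊆ A ++ a ∷ b ∷ B × AllPairs R D ×
            length (CA ++ b ∷ a ∷ CB) ⊓ length (CA′ ++ m ++ CB′) ≤ length D

  -- A chain of length k + 1 created by the swap, merged with any chain of A ++ M ++ B,
  -- gives a chain of the bounded word; so the latter chain has length at most k.
  Chains≤-swap-or-replace : Decidable R → ∀ k A a b B M → SwapChainsMerge A a b B M →
    Chains≤ k (A ++ a ∷ b ∷ B) → Chains≤ k (A ++ b ∷ a ∷ B) ⊎ Chains≤ k (A ++ M ++ B)
  Chains≤-swap-or-replace R? k A a b B M merge bounded with chains≤? R? k (A ++ b ∷ a ∷ B)
  ... | inj₁ swapped = inj₁ swapped
  ... | inj₂ (C , p , r , len) with ⊆-swap⁻ A a b p
  ...   | inj₁ q = ⊥-elim (1+n≰n (subst (_≤ k) len (bounded q r)))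
  ...   | inj₂ (CA , CB , pa , pb , refl) = inj₂ replaced
    where
    replaced : Chains≤ k (A ++ M ++ B)
    replaced p′ r′ with ⊆-++⁻ A p′
    ... | CA′ , _ , refl , pa′ , p₂ with ⊆-++⁻ M p₂
    ...   | m , CB′ , refl , pm , pb′ with merge pa pb pa′ pm pb′ r r′
    ...     | D , pd , rd , le with length (CA′ ++ m ++ CB′) ≤? k
    ...       | yes short = short
    ...       | no long   =
      ⊥-elim (1+n≰n (≤-trans (⊓-glb (≤-reflexive (sym len)) (≰⇒> long)) (≤-trans le (bounded pd rd))))

  SwapDominated : List ℕ → ℕ → ℕ → List ℕ → Set
  SwapDominated A a b B = ∀ k {SA SB} → SA ⊆ A → SB ⊆ B → Chains≤ k (SA ++ a ∷ b ∷ SB) →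
    ∃ λ S′ → S′ ⊆ A ++ b ∷ a ∷ B × Chains≤ k S′ × length S′ ≡ length (SA ++ a ∷ b ∷ SB)

  swap-≼ : ∀ A a b B → SwapDominated A a b B → A ++ a ∷ b ∷ B ≼ A ++ b ∷ a ∷ B
  swap-≼ A a b B dom k p bounded with ⊆-++⁻ A p
  ... | SA , _ , refl , pA , (.a ∷ʳ (.b ∷ʳ q)) = _ , ++⁺ pA (b ∷ʳ (a ∷ʳ q)) , bounded , refl
  ... | SA , _ , refl , pA , (.a ∷ʳ (refl ∷ q)) = _ , ++⁺ pA (refl ∷ (a ∷ʳ q)) , bounded , refl
  ... | SA , _ , refl , pA , (refl ∷ (.b ∷ʳ q)) = _ , ++⁺ pA (b ∷ʳ (refl ∷ q)) , bounded , refl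
  ... | SA , _ , refl , pA , (refl ∷ (refl ∷ q)) = dom k pA q bounded

  unrelated-swapDominated : ∀ A a b B → ¬ R b a → SwapDominated A a b B
  unrelated-swapDominated A a b B ¬bRa k {SA} {SB} pA pB bounded =
    SA ++ b ∷ a ∷ SB , ++⁺ pA (refl ∷ refl ∷ pB) ,
    Chains≤-swap SA a b SB (unrelated-swapChainsLift SA a b SB ¬bRa) bounded ,
    length-++-∷∷ SA b a a b SB

  -- y is the third letter of a Knuth move transposing a b; with respect to R it lies between b and a.
  module Guarded (R? : Decidable R) (R-trans : Transitive R) (y : ℕ) (a b : ℕ)
                 (yRc⇒bRc : ∀ {c} → R y c → R b c) (cRy⇒cRa : ∀ {c} → R c y → R c a) where

    mergeThrough : ∀ A B {CA CB CA′ CB′} → CA ⊆ A → CB ⊆ B → CA′ ⊆ A → CB′ ⊆ B →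
      AllPairs R (CA ++ b ∷ a ∷ CB) → AllPairs R (CA′ ++ y ∷ CB′) →
      ∃ λ D → D ⊆ A ++ a ∷ b ∷ B × AllPairs R D ×
              length (CA ++ b ∷ a ∷ CB) ⊓ length (CA′ ++ y ∷ CB′) ≤ length D
    mergeThrough A B {CA} {CB} {CA′} {CB′} pa pb pa′ pb′ r r′
      with AllPairs-++-∷⁻ CA r | AllPairs-++-∷⁻ CA′ r′ | length CA′ ≤? length CA
    ... | rCA , cRb , _ | _ , _ , yRCB′ ∷ rCB′ | yes CA′≤CA =
      CA ++ b ∷ CB′ , ++⁺ pa (a ∷ʳ refl ∷ pb′) ,
      AllPairs-++-∷⁺ R-trans rCA cRb (All.map yRc⇒bRc yRCB′ ∷ rCB′) ,
      (begin
        length (CA ++ b ∷ a ∷ CB) ⊓ length (CA′ ++ y ∷ CB′) ≤⟨ m⊓n≤n _ _ ⟩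
        length (CA′ ++ y ∷ CB′)                             ≡⟨ length-++ CA′ ⟩
        length CA′ + suc (length CB′)                       ≤⟨ +-monoˡ-≤ _ CA′≤CA ⟩
        length CA + suc (length CB′)                        ≡⟨ length-++ CA ⟨
        length (CA ++ b ∷ CB′)                              ∎)
      where open ≤-Reasoning
    ... | _ , _ , _ ∷ (aRCB ∷ rCB) | rCA′ , cRy , _ | no CA′≰CA =
      CA′ ++ a ∷ CB , ++⁺ pa′ (refl ∷ b ∷ʳ pb) ,
      AllPairs-++-∷⁺ R-trans rCA′ (All.map cRy⇒cRa cRy) (aRCB ∷ rCB) ,
      (begin
        length (CA ++ b ∷ a ∷ CB) ⊓ length (CA′ ++ y ∷ CB′) ≤⟨ m⊓n≤m _ _ ⟩
        length (CA ++ b ∷ a ∷ CB)                           ≡⟨ length-++ CA ⟩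
        length CA + suc (suc (length CB))                   ≡⟨ +-suc (length CA) _ ⟩
        suc (length CA) + suc (length CB)                   ≤⟨ +-monoˡ-≤ _ (≰⇒> CA′≰CA) ⟩
        length CA′ + suc (length CB)                        ≡⟨ length-++ CA′ ⟨
        length (CA′ ++ a ∷ CB)                              ∎)
      where open ≤-Reasoning

    mergeLeft : ∀ A B → ¬ R y b → SwapChainsMerge A a b B (y ∷ b ∷ [])
    mergeLeft A B ¬yRb {CA′ = CA′} pa pb pa′ (.y ∷ʳ (.b ∷ʳ [])) pb′ r r′ =
      CA′ ++ _ , ++⁺ pa′ (a ∷ʳ b ∷ʳ pb′) , r′ , m⊓n≤n _ _
    mergeLeft A B ¬yRb {CA′ = CA′} pa pb pa′ (.y ∷ʳ (refl ∷ [])) pb′ r r′ =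
      CA′ ++ b ∷ _ , ++⁺ pa′ (a ∷ʳ refl ∷ pb′) , r′ , m⊓n≤n _ _
    mergeLeft A B ¬yRb pa pb pa′ (refl ∷ (.b ∷ʳ [])) pb′ r r′ = mergeThrough A B pa pb pa′ pb′ r r′
    mergeLeft A B ¬yRb {CA′ = CA′} pa pb pa′ (refl ∷ (refl ∷ [])) pb′ r r′ with AllPairs-++-∷⁻ CA′ r′
    ... | _ , _ , (yRb ∷ _) ∷ _ = ⊥-elim (¬yRb yRb)

    mergeRight : ∀ A B → ¬ R a y → SwapChainsMerge A a b B (a ∷ y ∷ [])
    mergeRight A B ¬aRy {CA′ = CA′} pa pb pa′ (.a ∷ʳ (.y ∷ʳ [])) pb′ r r′ =
      CA′ ++ _ , ++⁺ pa′ (a ∷ʳ b ∷ʳ pb′) , r′ , m⊓n≤n _ _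
    mergeRight A B ¬aRy {CA′ = CA′} pa pb pa′ (refl ∷ (.y ∷ʳ [])) pb′ r r′ =
      CA′ ++ a ∷ _ , ++⁺ pa′ (refl ∷ b ∷ʳ pb′) , r′ , m⊓n≤n _ _
    mergeRight A B ¬aRy pa pb pa′ (.a ∷ʳ (refl ∷ [])) pb′ r r′ = mergeThrough A B pa pb pa′ pb′ r r′
    mergeRight A B ¬aRy {CA′ = CA′} pa pb pa′ (refl ∷ (refl ∷ [])) pb′ r r′ with AllPairs-++-∷⁻ CA′ r′
    ... | _ , _ , (aRy ∷ _) ∷ _ = ⊥-elim (¬aRy aRy)

    liftLeft : ∀ A B → (∀ {c} → R c b → R c y) → R y a → ¬ R y b → SwapChainsLift (A ++ [ y ]) a b B
    liftLeft A B cRb⇒cRy yRa ¬yRb {CA} {CB} pa pb r with ⊆-++-∷ʳ⁻ A y pa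
    ... | inj₂ (C , _ , refl) with AllPairs-++-∷⁻ C (subst (AllPairs R) (++-assoc C [ y ] _) r)
    ...   | _ , _ , (yRb ∷ _) ∷ _ = ⊥-elim (¬yRb yRb)
    liftLeft A B cRb⇒cRy yRa ¬yRb {CA} {CB} pa pb r | inj₁ q with AllPairs-++-∷⁻ CA r
    ... | rCA , cRb , _ ∷ (aRCB ∷ rCB) =
      CA ++ y ∷ a ∷ CB ,
      subst (CA ++ y ∷ a ∷ CB ⊆_) (sym (++-assoc A [ y ] _)) (++⁺ q (refl ∷ refl ∷ b ∷ʳ pb)) ,
      AllPairs-++-∷⁺ R-trans rCA (All.map cRb⇒cRy cRb) ((yRa ∷ All.map (R-trans yRa) aRCB) ∷ aRCB ∷ rCB) ,
      ≤-reflexive (length-++-∷∷ CA b a y a CB)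

    liftRight : ∀ A B → R b y → (∀ {c} → R a c → R y c) → ¬ R a y → SwapChainsLift A a b (y ∷ B)
    liftRight A B bRy aRc⇒yRc ¬aRy {CA} pa (refl ∷ pb) r with AllPairs-++-∷⁻ CA r
    ... | _ , _ , _ ∷ ((aRy ∷ _) ∷ _) = ⊥-elim (¬aRy aRy)
    liftRight A B bRy aRc⇒yRc ¬aRy {CA} {CB} pa (.y ∷ʳ pb) r with AllPairs-++-∷⁻ CA r
    ... | rCA , cRb , (_ ∷ bRCB) ∷ (aRCB ∷ rCB) =
      CA ++ b ∷ y ∷ CB , ++⁺ pa (a ∷ʳ refl ∷ refl ∷ pb) ,
      AllPairs-++-∷⁺ R-trans rCA cRb ((bRy ∷ bRCB) ∷ (All.map aRc⇒yRc aRCB ∷ rCB)) ,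
      ≤-reflexive (length-++-∷∷ CA b a b y CB)

    -- If the subsequence contains y, chains through the swapped pair are rerouted through y;
    -- otherwise either the swap creates no long chain, or y may replace a.
    guardedLeft-swapDominated : ∀ A B → (∀ {c} → R c b → R c y) → R y a → ¬ R y b →
                                SwapDominated (A ++ [ y ]) a b B
    guardedLeft-swapDominated A B cRb⇒cRy yRa ¬yRb k {SA} {SB} pA pB bounded with ⊆-++-∷ʳ⁻ A y pA
    ... | inj₂ (C , _ , refl) =
      (C ++ [ y ]) ++ b ∷ a ∷ SB , ++⁺ pA (refl ∷ refl ∷ pB) ,
      Chains≤-swap (C ++ [ y ]) a b SB (liftLeft C SB cRb⇒cRy yRa ¬yRb) bounded ,
      length-++-∷∷ (C ++ [ y ]) b a a b SB
    ... | inj₁ q with Chains≤-swap-or-replace R? k SA a b SB (y ∷ b ∷ []) (mergeLeft SA SB ¬yRb) bounded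
    ...   | inj₁ swapped =
      SA ++ b ∷ a ∷ SB , ++⁺ pA (refl ∷ refl ∷ pB) , swapped , length-++-∷∷ SA b a a b SB
    ...   | inj₂ replaced =
      SA ++ y ∷ b ∷ SB ,
      subst (SA ++ y ∷ b ∷ SB ⊆_) (sym (++-assoc A [ y ] _)) (++⁺ q (refl ∷ refl ∷ a ∷ʳ pB)) ,
      replaced , length-++-∷∷ SA y b a b SB

    guardedRight-swapDominated : ∀ A B → R b y → (∀ {c} → R a c → R y c) → ¬ R a y →
                                 SwapDominated A a b (y ∷ B)
    guardedRight-swapDominated A B bRy aRc⇒yRc ¬aRy k {SA} pA (refl ∷ q) bounded =
      SA ++ b ∷ a ∷ y ∷ _ , ++⁺ pA (refl ∷ refl ∷ refl ∷ q) ,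
      Chains≤-swap SA a b (y ∷ _) (liftRight SA _ bRy aRc⇒yRc ¬aRy) bounded ,
      length-++-∷∷ SA b a a b _
    guardedRight-swapDominated A B bRy aRc⇒yRc ¬aRy k {SA} {SB} pA (.y ∷ʳ q) bounded
      with Chains≤-swap-or-replace R? k SA a b SB (a ∷ y ∷ []) (mergeRight SA SB ¬aRy) bounded
    ... | inj₁ swapped =
      SA ++ b ∷ a ∷ SB , ++⁺ pA (refl ∷ refl ∷ y ∷ʳ q) , swapped , length-++-∷∷ SA b a a b SB
    ... | inj₂ replaced =
      SA ++ a ∷ y ∷ SB , ++⁺ pA (b ∷ʳ refl ∷ refl ∷ q) , replaced , length-++-∷∷ SA a y a b SB

  record KnuthInvariant : Set where
    field
      yxz≼yzx : ∀ p s {x y z} → x < y → y ≤ z → p ++ y ∷ x ∷ z ∷ s ≼ p ++ y ∷ z ∷ x ∷ s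
      yzx≼yxz : ∀ p s {x y z} → x < y → y ≤ z → p ++ y ∷ z ∷ x ∷ s ≼ p ++ y ∷ x ∷ z ∷ s
      xzy≼zxy : ∀ p s {x y z} → x ≤ y → y < z → p ++ x ∷ z ∷ y ∷ s ≼ p ++ z ∷ x ∷ y ∷ s
      zxy≼xzy : ∀ p s {x y z} → x ≤ y → y < z → p ++ z ∷ x ∷ y ∷ s ≼ p ++ x ∷ z ∷ y ∷ s

  ∼⇒≼ : KnuthInvariant → ∀ {u v} → u ∼ v → u ≼ v × v ≼ u
  ∼⇒≼ inv ∼-refl        = ≼-refl , ≼-refl
  ∼⇒≼ inv (∼-sym e)     = Product.swap (∼⇒≼ inv e)
  ∼⇒≼ inv (∼-trans e f) with ∼⇒≼ inv e | ∼⇒≼ inv f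
  ... | uv , vu | vw , wv = ≼-trans uv vw , ≼-trans wv vu
  ∼⇒≼ inv (yxz∼yzx p s x<y y≤z) = yxz≼yzx p s x<y y≤z , yzx≼yxz p s x<y y≤z
    where open KnuthInvariant inv
  ∼⇒≼ inv (xzy∼zxy p s x≤y y<z) = xzy≼zxy p s x≤y y<z , zxy≼xzy p s x≤y y<z
    where open KnuthInvariant inv

  swapAfter-≼ : ∀ p y a b s → SwapDominated (p ++ [ y ]) a b s → p ++ y ∷ a ∷ b ∷ s ≼ p ++ y ∷ b ∷ a ∷ s
  swapAfter-≼ p y a b s dom =
    subst₂ _≼_ (++-assoc p [ y ] _) (++-assoc p [ y ] _) (swap-≼ (p ++ [ y ]) a b s dom)

  OrderInvariant : Set
  OrderInvariant = ∀ {x y x′ y′} → SameCmp x y x′ y′ → R x x′ → R y y′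

  OrderIso-AllPairs : OrderInvariant → ∀ {xs ys} → OrderIso xs ys → AllPairs R xs → AllPairs R ys
  OrderIso-AllPairs inv []        []       = []
  OrderIso-AllPairs inv (w ∷ iso) (r ∷ rs) = heads w r ∷ OrderIso-AllPairs inv iso rs
    where
    heads : ∀ {x y xs ys} → Pointwise (SameCmp x y) xs ys → All (R x) xs → All (R y) ys
    heads []      []       = []
    heads (c ∷ w) (q ∷ qs) = inv c q ∷ heads w qs

  OrderIso⇒≼ : OrderInvariant → ∀ {xs ys} → OrderIso xs ys → xs ≼ ys
  OrderIso⇒≼ inv iso k p bounded =
    select p _ , select-⊆ iso p , bounded′ , sym (OrderIso-length (OrderIso-select iso p))
    where
    iso′ = OrderIso-sym (OrderIso-select iso p)
    bounded′ : Chains≤ k (select p _)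
    bounded′ q r = ≤-trans (≤-reflexive (OrderIso-length (OrderIso-select iso′ q)))
                           (bounded (select-⊆ iso′ q) (OrderIso-AllPairs inv (OrderIso-select iso′ q) r))

  ⪯⇒≼ : KnuthInvariant → OrderInvariant → ∀ σ π → σ ⪯ π → reading (Ptab σ) ≼ reading (Ptab π)
  ⪯⇒≼ knuth order σ π (τ , τ⊆π , σ≈τ) =
    ≼-trans (proj₂ (∼⇒≼ knuth (Ptab-∼ σ)))
    (≼-trans (OrderIso⇒≼ order (SameOrder⇒OrderIso σ τ σ≈τ))
    (≼-trans (⊆⇒≼ τ⊆π) (proj₁ (∼⇒≼ knuth (Ptab-∼ π)))))

module Rows = Greene _>_
module Columns = Greene _≤_

rows-knuthInvariant : Rows.KnuthInvariant
rows-knuthInvariant = record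
  { yxz≼yzx = λ p s {x} {y} {z} x<y y≤z → swapAfter-≼ p y x z s
      (guardedLeft-swapDominated y x z (λ c<y → <-≤-trans c<y y≤z) (<-trans x<y) p s
         (≤-<-trans y≤z) x<y (≤⇒≯ y≤z))
  ; yzx≼yxz = λ p s {x} {y} {z} x<y y≤z → swapAfter-≼ p y z x s
      (unrelated-swapDominated (p ++ [ y ]) z x s (<-asym (<-≤-trans x<y y≤z)))
  ; xzy≼zxy = λ p s {x} {y} {z} x≤y y<z → swap-≼ p x z (y ∷ s)
      (guardedRight-swapDominated y x z (λ c<y → <-trans c<y y<z) (≤-<-trans x≤y) p s
         y<z (λ c<x → <-≤-trans c<x x≤y) (≤⇒≯ x≤y))
  ; zxy≼xzy = λ p s {x} {y} {z} x≤y y<z → swap-≼ p z x (y ∷ s)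
      (unrelated-swapDominated p z x (y ∷ s) (<-asym (≤-<-trans x≤y y<z)))
  }
  where
  open Rows
  open Guarded _>?_ (λ p q → <-trans q p)

columns-knuthInvariant : Columns.KnuthInvariant
columns-knuthInvariant = record
  { yxz≼yzx = λ p s {x} {y} {z} x<y y≤z → swapAfter-≼ p y x z s
      (unrelated-swapDominated (p ++ [ y ]) x z s (<⇒≱ (<-≤-trans x<y y≤z)))
  ; yzx≼yxz = λ p s {x} {y} {z} x<y y≤z → swapAfter-≼ p y z x s
      (guardedLeft-swapDominated y z x (≤-trans (<⇒≤ x<y)) (λ c≤y → ≤-trans c≤y y≤z) p s
         (λ c≤x → ≤-trans c≤x (<⇒≤ x<y)) y≤z (<⇒≱ x<y))
  ; xzy≼zxy = λ p s {x} {y} {z} x≤y y<z → swap-≼ p x z (y ∷ s)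
      (unrelated-swapDominated p x z (y ∷ s) (<⇒≱ (≤-<-trans x≤y y<z)))
  ; zxy≼xzy = λ p s {x} {y} {z} x≤y y<z → swap-≼ p z x (y ∷ s)
      (guardedRight-swapDominated y z x (≤-trans x≤y) (λ c≤y → ≤-trans c≤y (<⇒≤ y<z)) p s
         x≤y (≤-trans (<⇒≤ y<z)) (<⇒≱ y<z))
  }
  where
  open Columns
  open Guarded _≤?_ ≤-trans

rows-orderInvariant : Rows.OrderInvariant
rows-orderInvariant (_ , x′<x⇔y′<y) = Equivalence.to x′<x⇔y′<y

columns-orderInvariant : Columns.OrderInvariant
columns-orderInvariant (_ , x′<x⇔y′<y) x≤x′ = ≮⇒≥ (λ y′<y → ≤⇒≯ x≤x′ (Equivalence.from x′<x⇔y′<y y′<y))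

count : {P : ℕ → Set} → (∀ a → Dec (P a)) → List ℕ → ℕ
count P? []      = 0
count P? (a ∷ r) with P? a
... | yes _ = suc (count P? r)
... | no _  = count P? r

count≤length : ∀ {P : ℕ → Set} (P? : ∀ a → Dec (P a)) r → count P? r ≤ length r
count≤length P? []      = z≤n
count≤length P? (a ∷ r) with P? a
... | yes _ = s≤s (count≤length P? r)
... | no _  = m≤n⇒m≤1+n (count≤length P? r)

countInRange : ℕ → ℕ → List ℕ → ℕ
countInRange c v []      = 0
countInRange c v (a ∷ r) with c ≤? a | a ≤? v
... | yes _ | yes _ = suc (countInRange c v r)
... | _     | _     = countInRange c v r

countInRange-⊆ : ∀ c v {C r} → C ⊆ r → All (c ≤_) C → All (_≤ v) C → length C ≤ countInRange c v r
countInRange-⊆ c v []       _ _ = z≤n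
countInRange-⊆ c v (a ∷ʳ p) c≤C C≤v with c ≤? a | a ≤? v
... | yes _ | yes _ = m≤n⇒m≤1+n (countInRange-⊆ c v p c≤C C≤v)
... | yes _ | no _  = countInRange-⊆ c v p c≤C C≤v
... | no _  | _     = countInRange-⊆ c v p c≤C C≤v
countInRange-⊆ c v (_∷_ {x = a} refl p) (c≤a ∷ c≤C) (a≤v ∷ C≤v) with c ≤? a | a ≤? v
... | yes _  | yes _  = s≤s (countInRange-⊆ c v p c≤C C≤v)
... | yes _  | no a≰v = ⊥-elim (a≰v a≤v)
... | no c≰a | _      = ⊥-elim (c≰a c≤a)

count<+countInRange≤count≤ : ∀ c v r → c ≤ v → count (_<? c) r + countInRange c v r ≤ count (_≤? v) r
count<+countInRange≤count≤ c v []      c≤v = z≤n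
count<+countInRange≤count≤ c v (a ∷ r) c≤v with a <? c | c ≤? a | a ≤? v
... | yes a<c | yes c≤a | _      = ⊥-elim (<⇒≱ a<c c≤a)
... | yes a<c | no _    | yes _  = s≤s (count<+countInRange≤count≤ c v r c≤v)
... | yes a<c | no _    | no a≰v = ⊥-elim (a≰v (≤-trans (<⇒≤ a<c) c≤v))
... | no _    | yes _   | yes _  = ≤-trans (≤-reflexive (+-suc _ _)) (s≤s (count<+countInRange≤count≤ c v r c≤v))
... | no _    | yes _   | no _   = count<+countInRange≤count≤ c v r c≤v
... | no _    | no _    | yes _  = m≤n⇒m≤1+n (count<+countInRange≤count≤ c v r c≤v)
... | no _    | no _    | no _   = count<+countInRange≤count≤ c v r c≤v

above-count≤ : ∀ v {r r₂} → r above r₂ → count (_≤? v) r₂ ≤ count (_≤? v) r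
above-count≤ v []                      = z≤n
above-count≤ v (_∷_ {b} {a} a<b ab) with b ≤? v | a ≤? v
... | yes _   | yes _   = s≤s (above-count≤ v ab)
... | yes b≤v | no a≰v  = ⊥-elim (a≰v (≤-trans (<⇒≤ a<b) b≤v))
... | no _    | yes _   = m≤n⇒m≤1+n (above-count≤ v ab)
... | no _    | no _    = above-count≤ v ab

above-count< : ∀ c {r r₂} → r above r₂ → count (_≤? c) r₂ ≤ count (_<? c) r
above-count< c []                      = z≤n
above-count< c (_∷_ {b} {a} a<b ab) with b ≤? c | a <? c
... | yes _   | yes _  = s≤s (above-count< c ab)
... | yes b≤c | no a≮c = ⊥-elim (a≮c (<-≤-trans a<b b≤c))
... | no _    | yes _  = m≤n⇒m≤1+n (above-count< c ab)
... | no _    | no _   = above-count< c ab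

-- Greene's invariants of a tableau

length-reading : ∀ T → length (reading T) ≡ sum (map length T)
length-reading []      = refl
length-reading (r ∷ T) = begin
  length (reading T ++ r)       ≡⟨ length-++ (reading T) ⟩
  length (reading T) + length r ≡⟨ cong (_+ length r) (length-reading T) ⟩
  sum (map length T) + length r ≡⟨ +-comm _ (length r) ⟩
  length r + sum (map length T) ∎
  where open ≡-Reasoning

reading-take-⊆ : ∀ k T → reading (take k T) ⊆ reading T
reading-take-⊆ zero    T       = []⊆-universal (reading T)
reading-take-⊆ (suc k) []      = []
reading-take-⊆ (suc k) (r ∷ T) = ++⁺ (reading-take-⊆ k T) ⊆-refl

decreasing-length≤rows : ∀ T → All NonDecreasing T → ∀ {C} → C ⊆ reading T → AllPairs _>_ C →
                         length C ≤ length T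
decreasing-length≤rows []      _          []  _   = z≤n
decreasing-length≤rows (r ∷ T) (r↑ ∷ T↑) p dec with ⊆-++⁻ (reading T) p
... | C₁ , C₂ , refl , p₁ , p₂ with AllPairs-++⁻ C₁ dec
...   | dec₁ , dec₂ , _ = begin
  length (C₁ ++ C₂)     ≡⟨ length-++ C₁ ⟩
  length C₁ + length C₂ ≤⟨ +-mono-≤ (decreasing-length≤rows T T↑ p₁ dec₁)
                                    (atMostOne (AllPairs-resp-⊆ p₂ r↑) dec₂) ⟩
  length T + 1          ≡⟨ +-comm (length T) 1 ⟩
  suc (length T)        ∎
  where
  open ≤-Reasoning
  atMostOne : ∀ {C} → NonDecreasing C → AllPairs _>_ C → length C ≤ 1
  atMostOne {[]}        _                 _                 = z≤n
  atMostOne {_ ∷ []}    _                 _                 = s≤s z≤n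
  atMostOne {_ ∷ _ ∷ _} ((x≤y ∷ _) ∷ _) ((x>y ∷ _) ∷ _) = ⊥-elim (<⇒≱ x>y x≤y)

rows-attained : ∀ k T → All NonDecreasing T →
                ∃ λ S → S ⊆ reading T × Rows.Chains≤ k S × length S ≡ sum (take k (map length T))
rows-attained k T T↑ =
  reading (take k T) , reading-take-⊆ k T ,
  (λ p dec → ≤-trans (decreasing-length≤rows (take k T) (All.take⁺ k T↑) p dec)
                     (≤-trans (≤-reflexive (length-take k T)) (m⊓n≤m k _))) ,
  trans (length-reading (take k T)) (cong sum (sym (take-map k T)))

columns-bounded : ∀ k T → All NonDecreasing T → ∀ {S} → S ⊆ reading T → Columns.Chains≤ k S →
                  length S ≤ sum (map (k ⊓_) (map length T))
columns-bounded k []      _          []  _       = z≤n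
columns-bounded k (r ∷ T) (r↑ ∷ T↑) p bounded with ⊆-++⁻ (reading T) p
... | S₁ , S₂ , refl , p₁ , p₂ = begin
  length (S₁ ++ S₂)                              ≡⟨ length-++ S₁ ⟩
  length S₁ + length S₂                          ≤⟨ +-mono-≤ lower top ⟩
  sum (map (k ⊓_) (map length T)) + k ⊓ length r ≡⟨ +-comm _ (k ⊓ length r) ⟩
  k ⊓ length r + sum (map (k ⊓_) (map length T)) ∎
  where
  open ≤-Reasoning
  lower = columns-bounded k T T↑ p₁ (Columns.Chains≤-resp-⊆ (++⁺ʳ S₂ ⊆-refl) bounded)
  top   = ⊓-glb (bounded (++⁺ˡ S₁ ⊆-refl) (AllPairs-resp-⊆ p₂ r↑)) (length-mono-≤ p₂)

take-above : ∀ k {r r₂} → r above r₂ → take k r above take k r₂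
take-above zero    _          = []
take-above (suc k) []         = []
take-above (suc k) (a<b ∷ ab) = a<b ∷ take-above k ab

increasing-length≤count : ∀ k T → ColumnStrict T → ∀ v {C} → C ⊆ reading (map (take k) T) →
                          AllPairs _≤_ C → All (_≤ v) C → length C ≤ count (_≤? v) (take k (headRow T))
increasing-length≤count k []      _         v []  _   _   = z≤n
increasing-length≤count k (r ∷ T) (ab ∷ T↓) v p inc C≤v with ⊆-++⁻ (reading (map (take k) T)) p
... | C′ , [] , refl , p′ , _ = begin
  length (C′ ++ [])                  ≡⟨ length-++ C′ ⟩
  length C′ + 0                      ≡⟨ +-identityʳ _ ⟩
  length C′                          ≤⟨ increasing-length≤count k T T↓ v p′
                                          (proj₁ (AllPairs-++⁻ C′ inc)) (All.++⁻ˡ C′ C≤v) ⟩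
  count (_≤? v) (take k (headRow T)) ≤⟨ above-count≤ v (take-above k ab) ⟩
  count (_≤? v) (take k r)           ∎
  where open ≤-Reasoning
... | C′ , c ∷ C₁ , refl , p′ , p₁ with AllPairs-++-∷⁻ C′ inc | All.++⁻ʳ C′ C≤v
...   | inc′ , C′≤c , c≤C₁ ∷ _ | c≤v ∷ C₁≤v = begin
  length (C′ ++ c ∷ C₁)                                  ≡⟨ length-++ C′ ⟩
  length C′ + length (c ∷ C₁)                            ≤⟨ +-mono-≤ lower top ⟩
  count (_<? c) (take k r) + countInRange c v (take k r) ≤⟨ count<+countInRange≤count≤ c v (take k r) c≤v ⟩
  count (_≤? v) (take k r)                               ∎
  where
  open ≤-Reasoning
  lower = ≤-trans (increasing-length≤count k T T↓ c p′ inc′ C′≤c) (above-count< c (take-above k ab))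
  top   = countInRange-⊆ c v p₁ (≤-refl ∷ c≤C₁) (c≤v ∷ C₁≤v)

All-≤-maxList : ∀ l → All (_≤ maxList l) l
All-≤-maxList []      = []
All-≤-maxList (x ∷ l) = m≤m⊔n x (maxList l) ∷ All.map (λ y≤ → ≤-trans y≤ (m≤n⊔m x (maxList l))) (All-≤-maxList l)

reading-map-take-⊆ : ∀ k T → reading (map (take k) T) ⊆ reading T
reading-map-take-⊆ k []      = []
reading-map-take-⊆ k (r ∷ T) = ++⁺ (reading-map-take-⊆ k T) (take-⊆ k r)

sum-length-map-take : ∀ k (T : Tableau) → sum (map length (map (take k) T)) ≡ sum (map (k ⊓_) (map length T))
sum-length-map-take k []      = refl
sum-length-map-take k (r ∷ T) = cong₂ _+_ (length-take k r) (sum-length-map-take k T)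

columns-attained : ∀ k T → ColumnStrict T →
                   ∃ λ S → S ⊆ reading T × Columns.Chains≤ k S × length S ≡ sum (map (k ⊓_) (map length T))
columns-attained k T T↓ =
  reading (map (take k) T) , reading-map-take-⊆ k T , bounded ,
  trans (length-reading (map (take k) T)) (sum-length-map-take k T)
  where
  bounded : Columns.Chains≤ k (reading (map (take k) T))
  bounded {C} p inc = begin
    length C                                    ≤⟨ increasing-length≤count k T T↓ (maxList C) p inc (All-≤-maxList C) ⟩
    count (_≤? maxList C) (take k (headRow T))  ≤⟨ count≤length (_≤? maxList C) (take k (headRow T)) ⟩
    length (take k (headRow T))                 ≡⟨ length-take k (headRow T) ⟩
    k ⊓ length (headRow T)                      ≤⟨ m⊓n≤m k _ ⟩
    k                                           ∎
    where open ≤-Reasoning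

infixr 5 _⊕_

_⊕_ : List ℕ → List ℕ → List ℕ
[]       ⊕ ys       = ys
(x ∷ xs) ⊕ []       = x ∷ xs
(x ∷ xs) ⊕ (y ∷ ys) = x + y ∷ xs ⊕ ys

⊕-identityʳ : ∀ xs → xs ⊕ [] ≡ xs
⊕-identityʳ []      = refl
⊕-identityʳ (_ ∷ _) = refl

sum-⊕ : ∀ xs ys → sum (xs ⊕ ys) ≡ sum xs + sum ys
sum-⊕ []       ys       = refl
sum-⊕ (x ∷ xs) []       = sym (+-identityʳ _)
sum-⊕ (x ∷ xs) (y ∷ ys) = begin
  x + y + sum (xs ⊕ ys)      ≡⟨ cong (x + y +_) (sum-⊕ xs ys) ⟩
  x + y + (sum xs + sum ys)  ≡⟨ +-assoc x y _ ⟩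
  x + (y + (sum xs + sum ys)) ≡⟨ cong (x +_) (+-comm y _) ⟩
  x + ((sum xs + sum ys) + y) ≡⟨ cong (x +_) (+-assoc (sum xs) _ _) ⟩
  x + (sum xs + (sum ys + y)) ≡⟨ cong (λ z → x + (sum xs + z)) (+-comm (sum ys) y) ⟩
  x + (sum xs + (y + sum ys)) ≡⟨ +-assoc x _ _ ⟨
  x + sum xs + (y + sum ys)   ∎
  where open ≡-Reasoning

length-⊕ : ∀ xs ys → length ys ≤ length xs → length (xs ⊕ ys) ≡ length xs
length-⊕ []       []       _         = refl
length-⊕ (x ∷ xs) []       _         = refl
length-⊕ (x ∷ xs) (y ∷ ys) (s≤s ≤len) = cong suc (length-⊕ xs ys ≤len)

⊕-mono-≤ : ∀ {xs xs′ ys ys′} → Prefix _≤_ xs xs′ → Prefix _≤_ ys ys′ → Prefix _≤_ (xs ⊕ ys) (xs′ ⊕ ys′)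
⊕-mono-≤ {xs′ = xs′} []        ys≤ = ⊕-monoʳ xs′ ys≤
  where
  ⊕-monoʳ : ∀ xs′ {ys ys′} → Prefix _≤_ ys ys′ → Prefix _≤_ ys (xs′ ⊕ ys′)
  ⊕-monoʳ []        ys≤         = ys≤
  ⊕-monoʳ (x ∷ xs′) []          = []
  ⊕-monoʳ (x ∷ xs′) (y≤ ∷ ys≤) = ≤-trans y≤ (m≤n+m _ x) ∷ ⊕-monoʳ xs′ ys≤
⊕-mono-≤ {ys′ = ys′} (x≤ ∷ xs≤) [] = ⊕-monoˡ ys′ (x≤ ∷ xs≤)
  where
  ⊕-monoˡ : ∀ ys′ {xs xs′} → Prefix _≤_ xs xs′ → Prefix _≤_ xs (xs′ ⊕ ys′)
  ⊕-monoˡ ys′       []          = []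
  ⊕-monoˡ []        (x≤ ∷ xs≤) = x≤ ∷ xs≤
  ⊕-monoˡ (y ∷ ys′) (x≤ ∷ xs≤) = ≤-trans x≤ (m≤m+n _ y) ∷ ⊕-monoˡ ys′ xs≤
⊕-mono-≤ (x≤ ∷ xs≤) (y≤ ∷ ys≤) = +-mono-≤ x≤ y≤ ∷ ⊕-mono-≤ xs≤ ys≤

ones : List ℕ → List ℕ
ones = map (λ _ → 1)

marks : ∀ {S r : List ℕ} → S ⊆ r → List ℕ
marks []       = []
marks (_ ∷ʳ p) = 0 ∷ marks p
marks (_ ∷ p)  = 1 ∷ marks p

marks≤ones : ∀ {S r : List ℕ} (p : S ⊆ r) → Prefix _≤_ (marks p) (ones r)
marks≤ones []         = []
marks≤ones (_ ∷ʳ p)   = z≤n ∷ marks≤ones p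
marks≤ones (refl ∷ p) = ≤-refl ∷ marks≤ones p

sum-marks : ∀ {S r : List ℕ} (p : S ⊆ r) → sum (marks p) ≡ length S
sum-marks []         = refl
sum-marks (_ ∷ʳ p)   = sum-marks p
sum-marks (refl ∷ p) = cong suc (sum-marks p)

columnHeights : Tableau → List ℕ
columnHeights []      = []
columnHeights (r ∷ T) = ones r ⊕ columnHeights T

ColumnChain : List ℕ → ℕ → ℕ → Set
ColumnChain S n t = ∃ λ C → C ⊆ S × AllPairs _>_ C × length C ≡ n × All (t ≤_) C

singletonChains : ∀ {U S r} (p : S ⊆ r) → S ⊆ U → Pointwise (ColumnChain U) (marks p) r
singletonChains []                  _   = []
singletonChains {U} (_ ∷ʳ p)        emb = ([] , []⊆-universal U , [] , refl , []) ∷ singletonChains p emb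
singletonChains {S = y ∷ S} (refl ∷ p) emb =
  ([ y ] , ⊆-trans (refl ∷ []⊆-universal S) emb , [] ∷ [] , refl , ≤-refl ∷ []) ∷
  singletonChains p (∷ˡ⁻ emb)

columnChains-∷ : ∀ {U S′ S r r₂ ns} (p : S ⊆ r) → r above r₂ → Pointwise (ColumnChain S′) ns r₂ →
                 S′ ++ S ⊆ U → Pointwise (ColumnChain U) (marks p ⊕ ns) r
columnChains-∷ {U} {S′} p [] [] emb =
  subst (λ ns → Pointwise (ColumnChain U) ns _) (sym (⊕-identityʳ (marks p)))
        (singletonChains p (⊆-trans (++⁺ˡ S′ ⊆-refl) emb))
columnChains-∷ {S = S} (y ∷ʳ p) (y<b ∷ ab) ((C , C⊆ , dec , len , b≤C) ∷ chains) emb =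
  (C , ⊆-trans C⊆ (⊆-trans (++⁺ʳ S ⊆-refl) emb) , dec , len , All.map (≤-trans (<⇒≤ y<b)) b≤C) ∷
  columnChains-∷ p ab chains emb
columnChains-∷ {S′ = S′} {S = y ∷ S} (refl ∷ p) (y<b ∷ ab) ((C , C⊆ , dec , len , b≤C) ∷ chains) emb =
  (C ++ [ y ] , ⊆-trans (++⁺ C⊆ (refl ∷ []⊆-universal S)) emb ,
   AllPairs.++⁺ dec ([] ∷ []) (All.map (λ b≤c → <-≤-trans y<b b≤c ∷ []) b≤C) ,
   trans (length-++ C) (trans (+-comm (length C) 1) (cong suc len)) ,
   All.++⁺ (All.map (≤-trans (<⇒≤ y<b)) b≤C) (≤-refl ∷ [])) ∷
  columnChains-∷ p ab chains (⊆-trans (++⁺ (⊆-refl {x = S′}) (y ∷ʳ ⊆-refl)) emb)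

-- ns counts the entries of S in each column; the entries of one column form a decreasing chain.
columnDecomposition : ∀ T → ColumnStrict T → ∀ {S} → S ⊆ reading T →
  ∃ λ ns → length S ≡ sum ns × Prefix _≤_ ns (columnHeights T) × Pointwise (ColumnChain S) ns (headRow T)
columnDecomposition []      []        []  = [] , refl , [] , []
columnDecomposition (r ∷ T) (ab ∷ T↓) p with ⊆-++⁻ (reading T) p
... | S′ , S , refl , p′ , p₁ with columnDecomposition T T↓ p′
...   | ns , len , ns≤ , chains =
  marks p₁ ⊕ ns ,
  (begin
    length (S′ ++ S)          ≡⟨ length-++ S′ ⟩
    length S′ + length S      ≡⟨ cong₂ _+_ len (sym (sum-marks p₁)) ⟩
    sum ns + sum (marks p₁)   ≡⟨ +-comm (sum ns) _ ⟩
    sum (marks p₁) + sum ns   ≡⟨ sum-⊕ (marks p₁) ns ⟨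
    sum (marks p₁ ⊕ ns)       ∎) ,
  ⊕-mono-≤ (marks≤ones p₁) ns≤ ,
  columnChains-∷ p₁ ab chains ⊆-refl
  where open ≡-Reasoning

columnChains-≤ : ∀ {k S ns r} → Pointwise (ColumnChain S) ns r → Rows.Chains≤ k S → All (_≤ k) ns
columnChains-≤ []                                 bounded = []
columnChains-≤ ((C , C⊆ , dec , refl , _) ∷ chains) bounded = bounded C⊆ dec ∷ columnChains-≤ chains bounded

sum≤sum-⊓ : ∀ k {ns hs} → Prefix _≤_ ns hs → All (_≤ k) ns → sum ns ≤ sum (map (k ⊓_) hs)
sum≤sum-⊓ k []         _            = z≤n
sum≤sum-⊓ k (n≤h ∷ ns≤) (n≤k ∷ ns≤k) = +-mono-≤ (⊓-glb n≤k n≤h) (sum≤sum-⊓ k ns≤ ns≤k)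

length-columnHeights : ∀ T → ColumnStrict T → length (columnHeights T) ≡ length (headRow T)
length-columnHeights []      []        = refl
length-columnHeights (r ∷ T) (ab ∷ T↓) = begin
  length (ones r ⊕ columnHeights T) ≡⟨ length-⊕ (ones r) _ lengths ⟩
  length (ones r)                   ≡⟨ length-map _ r ⟩
  length r                          ∎
  where
  open ≡-Reasoning
  lengths : length (columnHeights T) ≤ length (ones r)
  lengths = subst₂ _≤_ (sym (length-columnHeights T T↓)) (sym (length-map _ r)) (Prefix.length-mono ab)

sum-⊓-ones-⊕ : ∀ k r hs → length hs ≤ length r →
               sum (map (suc k ⊓_) (ones r ⊕ hs)) ≡ length r + sum (map (k ⊓_) hs)
sum-⊓-ones-⊕ k []      []       _          = refl
sum-⊓-ones-⊕ k r@(_ ∷ _) []       _          = trans (sum-⊓-ones r) (sym (+-identityʳ _))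
  where
  sum-⊓-ones : ∀ r → sum (map (suc k ⊓_) (ones r)) ≡ length r
  sum-⊓-ones []      = refl
  sum-⊓-ones (_ ∷ r) = cong₂ _+_ (cong suc (⊓-zeroʳ k)) (sum-⊓-ones r)
sum-⊓-ones-⊕ k (_ ∷ r) (h ∷ hs) (s≤s ≤len) = cong suc (begin
  k ⊓ h + sum (map (suc k ⊓_) (ones r ⊕ hs)) ≡⟨ cong (k ⊓ h +_) (sum-⊓-ones-⊕ k r hs ≤len) ⟩
  k ⊓ h + (length r + sum (map (k ⊓_) hs))    ≡⟨ +-assoc (k ⊓ h) _ _ ⟨
  k ⊓ h + length r + sum (map (k ⊓_) hs)      ≡⟨ cong (_+ sum (map (k ⊓_) hs)) (+-comm (k ⊓ h) _) ⟩
  length r + k ⊓ h + sum (map (k ⊓_) hs)      ≡⟨ +-assoc (length r) _ _ ⟩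
  length r + (k ⊓ h + sum (map (k ⊓_) hs))    ∎)
  where open ≡-Reasoning

-- The column heights form the conjugate shape, so their k-truncated sum is the sum of the first k rows.
sum-⊓-columnHeights : ∀ k T → ColumnStrict T → sum (map (k ⊓_) (columnHeights T)) ≡ sum (take k (map length T))
sum-⊓-columnHeights zero    T       _         = sum-zero (columnHeights T)
  where
  sum-zero : ∀ hs → sum (map (zero ⊓_) hs) ≡ 0
  sum-zero []       = refl
  sum-zero (_ ∷ hs) = sum-zero hs
sum-⊓-columnHeights (suc k) []      _         = refl
sum-⊓-columnHeights (suc k) (r ∷ T) (ab ∷ T↓) =
  trans (sum-⊓-ones-⊕ k r (columnHeights T) lengths) (cong (length r +_) (sum-⊓-columnHeights k T T↓))
  where
  lengths : length (columnHeights T) ≤ length r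
  lengths = subst (_≤ length r) (sym (length-columnHeights T T↓)) (Prefix.length-mono ab)

rows-bounded : ∀ k T → ColumnStrict T → ∀ {S} → S ⊆ reading T → Rows.Chains≤ k S →
               length S ≤ sum (take k (map length T))
rows-bounded k T T↓ {S} p bounded with columnDecomposition T T↓ p
... | ns , len , ns≤ , chains = begin
  length S                              ≡⟨ len ⟩
  sum ns                                ≤⟨ sum≤sum-⊓ k ns≤ (columnChains-≤ chains bounded) ⟩
  sum (map (k ⊓_) (columnHeights T))    ≡⟨ sum-⊓-columnHeights k T T↓ ⟩
  sum (take k (map length T))           ∎
  where open ≤-Reasoning

-- Partial sums of the conjugate partition

conjEntry : List ℕ → ℕ → ℕ
conjEntry l i = length (filter (λ x → suc i ≤? x) l)

conjEntry-suc : ∀ l i → conjEntry l (suc i) ≡ conjEntry (map pred l) i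
conjEntry-suc []          i = refl
conjEntry-suc (zero ∷ l)  i = conjEntry-suc l i
conjEntry-suc (suc x ∷ l) i with i <ᵇ x
... | true  = cong suc (conjEntry-suc l i)
... | false = conjEntry-suc l i

applyUpTo-cong : ∀ {f g : ℕ → ℕ} n → (∀ i → f i ≡ g i) → applyUpTo f n ≡ applyUpTo g n
applyUpTo-cong zero    f≗g = refl
applyUpTo-cong (suc n) f≗g = cong₂ _∷_ (f≗g 0) (applyUpTo-cong n (λ i → f≗g (suc i)))

take-applyUpTo : ∀ (f : ℕ → ℕ) k n → take k (applyUpTo f n) ≡ applyUpTo f (k ⊓ n)
take-applyUpTo f zero    n       = refl
take-applyUpTo f (suc k) zero    = refl
take-applyUpTo f (suc k) (suc n) = cong (f 0 ∷_) (take-applyUpTo (λ i → f (suc i)) k n)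

-- Peeling the first column off every part lowers each part by one.
conjEntry-zero-+ : ∀ n l → conjEntry l 0 + sum (map (n ⊓_) (map pred l)) ≡ sum (map (suc n ⊓_) l)
conjEntry-zero-+ n []          = refl
conjEntry-zero-+ n (zero ∷ l)  =
  trans (cong (λ m → conjEntry l 0 + (m + sum (map (n ⊓_) (map pred l)))) (⊓-zeroʳ n)) (conjEntry-zero-+ n l)
conjEntry-zero-+ n (suc x ∷ l) =
  cong suc (trans (+-exch (conjEntry l 0) (n ⊓ x) _) (cong (n ⊓ x +_) (conjEntry-zero-+ n l)))
  where
  +-exch : ∀ a b c → a + (b + c) ≡ b + (a + c)
  +-exch a b c = trans (sym (+-assoc a b c)) (trans (cong (_+ c) (+-comm a b)) (+-assoc b a c))

sum-applyUpTo-conjEntry : ∀ n l → sum (applyUpTo (conjEntry l) n) ≡ sum (map (n ⊓_) l)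
sum-applyUpTo-conjEntry zero    l = sym (sum-zero l)
  where
  sum-zero : ∀ l → sum (map (zero ⊓_) l) ≡ 0
  sum-zero []      = refl
  sum-zero (_ ∷ l) = sum-zero l
sum-applyUpTo-conjEntry (suc n) l = begin
  conjEntry l 0 + sum (applyUpTo (λ i → conjEntry l (suc i)) n)
    ≡⟨ cong (λ xs → conjEntry l 0 + sum xs) (applyUpTo-cong n (conjEntry-suc l)) ⟩
  conjEntry l 0 + sum (applyUpTo (conjEntry (map pred l)) n)
    ≡⟨ cong (conjEntry l 0 +_) (sum-applyUpTo-conjEntry n (map pred l)) ⟩
  conjEntry l 0 + sum (map (n ⊓_) (map pred l))
    ≡⟨ conjEntry-zero-+ n l ⟩
  sum (map (suc n ⊓_) l)
    ∎
  where open ≡-Reasoning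

sum-⊓-⊓-bound : ∀ k m l → All (_≤ m) l → sum (map ((k ⊓ m) ⊓_) l) ≡ sum (map (k ⊓_) l)
sum-⊓-⊓-bound k m []      _           = refl
sum-⊓-⊓-bound k m (x ∷ l) (x≤m ∷ l≤m) =
  cong₂ _+_ (trans (⊓-assoc k m x) (cong (k ⊓_) (m≥n⇒m⊓n≡n x≤m))) (sum-⊓-⊓-bound k m l l≤m)

conj-sum : ∀ k l → sum (take k (conj l)) ≡ sum (map (k ⊓_) l)
conj-sum k l = begin
  sum (take k (conj l))                                ≡⟨ cong sum (take-applyUpTo (conjEntry l) k (maxList l)) ⟩
  sum (applyUpTo (conjEntry l) (k ⊓ maxList l))        ≡⟨ sum-applyUpTo-conjEntry (k ⊓ maxList l) l ⟩
  sum (map ((k ⊓ maxList l) ⊓_) l)                     ≡⟨ sum-⊓-⊓-bound k (maxList l) l (All-≤-maxList l) ⟩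
  sum (map (k ⊓_) l)                                   ∎
  where open ≡-Reasoning

corollary2 : (σ π : List ℕ) → IsPerm σ → IsPerm π → σ ⪯ π → sh σ ⊑ sh π
corollary2 σ π _ _ σ⪯π = rows , columns
  where
  rows : sh σ ⊴ sh π
  rows k = Rows.≼⇒≤ (Rows.⪯⇒≼ rows-knuthInvariant rows-orderInvariant σ π σ⪯π) k
             (rows-attained k (Ptab σ) (Ptab-rows σ)) (rows-bounded k (Ptab π) (Ptab-columns π))
  columns : conj (sh σ) ⊴ conj (sh π)
  columns k = subst₂ _≤_ (sym (conj-sum k (sh σ))) (sym (conj-sum k (sh π)))
    (Columns.≼⇒≤ (Columns.⪯⇒≼ columns-knuthInvariant columns-orderInvariant σ π σ⪯π) k
       (columns-attained k (Ptab σ) (Ptab-columns σ)) (columns-bounded k (Ptab π) (Ptab-rows π)))
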